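{- For any simple program $\mathcal H$: (a) if $\mathcal H$ is FT-tight then every FLP-stable model of $\mathcal H$ is an FT-stable model of $\mathcal H$; (b) if $\mathcal H$ is FLP-tight then every FT-stable model of $\mathcal H$ is an FLP-stable model of $\mathcal H$.
   Context: Infinitary propositional formulas over a signature $\sigma$ are built from atoms by forming $\mathcal H^\land$, $\mathcal H^\lor$ for arbitrary sets $\mathcal H$ of previously formed formulas, and $F\to G$; $\top=\emptyset^\land$, $\bot=\emptyset^\lor$, $\neg F=F\to\bot$. Interpretations are subsets of $\sigma$, with the usual satisfaction relation. FLP-reduct: for a set $\mathcal H$ of formulas $G\to H$ with $H$ a disjunction of atoms, $FLP(\mathcal H,I)$ consists of those $G\to H\in\mathcal H$ with $I\models G$; $I$ is FLP-stable if it is a $\subseteq$-minimal model of $FLP(\mathcal H,I)$. FT-reduct: $FT(p,I)=p$ if $p\in I$ else $\bot$; $FT(\mathcal H^\land,I)=\{FT(G,I):G\in\mathcal H\}^\land$, similarly for $\lor$; $FT(G\to H,I)=\bot$ if $I\not\models G\to H$, else $FT(G,I)\to FT(H,I)$; applied elementwise to sets; $I$ is FT-stable if it is a $\subseteq$-minimal model of $FT(\mathcal H,I)$. Extended literals: $p,\neg p,\neg\neg p$ for atoms $p$. A simple disjunction is a disjunction of extended literals. A simple implication is $\mathcal A^\land\to\mathcal L^\lor$ with $\mathcal A$ a set of atoms and $\mathcal L^\lor$ a simple disjunction; it is positive if $\mathcal L$ is a set of atoms, non-positive otherwise. A simple formula is a conjunction of simple implications. A simple rule is $G\to H$ with $G$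 a simple formula and $H$ a disjunction of atoms; a simple program is a set of simple rules. An atom $p$ occurs strictly positively in a simple formula $F$ if $p\in\mathcal L$ for some conjunctive term $\mathcal A^\land\to\mathcal L^\lor$ of $F$, and occurs positively if $p$ or $\neg\neg p$ belongs to such an $\mathcal L$. The dependency graph of a simple program $\mathcal H$ has all atoms occurring in $\mathcal H$ as vertices and an edge from $p$ to $q$ if for some $G\to H\in\mathcal H$, $p$ is a disjunctive term of $H$ and $q$ occurs positively in $G$. Such an edge is FT-critical if for some $G\to H\in\mathcal H$, $p$ is a disjunctive term of $H$ and $q$ occurs strictly positively in some non-positive conjunctive term of $G$; it is FLP-critical if for some $G\to H\in\mathcal H$, $p$ is a disjunctive term of $H$ and $\neg\neg q\in\mathcal L$ for some conjunctive term $\mathcal A^\land\to\mathcal L^\lor$ of $G$. $\mathcal H$ is FT-tight (resp. FLP-tight) if its dependency graph has no path containing infinitely many FT-critical (resp. FLP-critical) edges. -}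

module Defs where

open import Level using (0ℓ)
open import Data.Empty using (⊥; ⊥-elim)
open import Data.Product using (Σ; Σ-syntax; ∃; ∃-syntax; _×_; _,_; proj₁)
open import Data.Sum using (_⊎_)
open import Data.Nat using (ℕ; suc; _≤_)
open import Relation.Nullary using (¬_; Dec; yes; no)
open import Axiom.ExcludedMiddle using (ExcludedMiddle)

-- Infinitary propositional formulas over a signature σ.
-- "A set 𝓗 of formulas" is represented as an indexed family (K , f)
-- with K : Set and f : K → Formula σ.

data Formula (σ : Set) : Set₁ where
  atom : σ → Formula σ
  ⋀    : (K : Set) → (K → Formula σ) → Formula σ
  ⋁    : (K : Set) → (K → Formula σ) → Formula σ
  _⇒_  : Formula σ → Formula σ → Formula σ

infixr 5 _⇒_

⊤F : {σ : Set} → Formula σ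
⊤F = ⋀ ⊥ ⊥-elim

⊥F : {σ : Set} → Formula σ
⊥F = ⋁ ⊥ ⊥-elim

¬F : {σ : Set} → Formula σ → Formula σ
¬F F = F ⇒ ⊥F

FormulaSet : Set → Set₁
FormulaSet σ = Σ Set (λ K → K → Formula σ)

Interp : Set → Set₁
Interp σ = σ → Set

_⊆_ : {σ : Set} → Interp σ → Interp σ → Set
J ⊆ I = ∀ p → J p → I p

_⊨_ : {σ : Set} → Interp σ → Formula σ → Set
I ⊨ atom p  = I p
I ⊨ ⋀ K f   = (k : K) → I ⊨ f k
I ⊨ ⋁ K f   = Σ K (λ k → I ⊨ f k)
I ⊨ (F ⇒ G) = I ⊨ F → I ⊨ G

_⊨ˢ_ : {σ : Set} → Interp σ → FormulaSet σ → Set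
I ⊨ˢ (K , f) = (k : K) → I ⊨ f k

MinimalModel : {σ : Set} → Interp σ → FormulaSet σ → Set₁
MinimalModel {σ} I S = I ⊨ˢ S × ((J : Interp σ) → J ⊆ I → J ⊨ˢ S → I ⊆ J)

data ExtLit (σ : Set) : Set where
  pos    : σ → ExtLit σ
  neg    : σ → ExtLit σ
  negneg : σ → ExtLit σ

⟦_⟧ˡ : {σ : Set} → ExtLit σ → Formula σ
⟦ pos p ⟧ˡ    = atom p
⟦ neg p ⟧ˡ    = ¬F (atom p)
⟦ negneg p ⟧ˡ = ¬F (¬F (atom p))

record SimpleImpl (σ : Set) : Set₁ where
  field
    𝓐 : σ → Set
    𝓛 : ExtLit σ → Set
open SimpleImpl public

⟦_⟧ⁱ : {σ : Set} → SimpleImpl σ → Formula σ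
⟦ s ⟧ⁱ = ⋀ (Σ _ (𝓐 s)) (λ a → atom (proj₁ a)) ⇒ ⋁ (Σ _ (𝓛 s)) (λ l → ⟦ proj₁ l ⟧ˡ)

NonPositive : {σ : Set} → SimpleImpl σ → Set
NonPositive {σ} s = Σ σ (λ p → 𝓛 s (neg p) ⊎ 𝓛 s (negneg p))

SimpleFormula : Set → Set₁
SimpleFormula σ = Σ Set (λ K → K → SimpleImpl σ)

⟦_⟧ᶠ : {σ : Set} → SimpleFormula σ → Formula σ
⟦ K , f ⟧ᶠ = ⋀ K (λ k → ⟦ f k ⟧ⁱ)

record SimpleRule (σ : Set) : Set₁ where
  field
    body : SimpleFormula σ
    head : σ → Set
open SimpleRule public

⟦_⟧ʳ : {σ : Set} → SimpleRule σ → Formula σ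
⟦ r ⟧ʳ = ⟦ body r ⟧ᶠ ⇒ ⋁ (Σ _ (head r)) (λ a → atom (proj₁ a))

SimpleProgram : Set → Set₁
SimpleProgram σ = Σ Set (λ R → R → SimpleRule σ)

⟦_⟧ᵖ : {σ : Set} → SimpleProgram σ → FormulaSet σ
⟦ R , rs ⟧ᵖ = R , (λ r → ⟦ rs r ⟧ʳ)

StrictlyPositiveIn : {σ : Set} → σ → SimpleFormula σ → Set
StrictlyPositiveIn q (K , f) = Σ K (λ k → 𝓛 (f k) (pos q))

PositiveIn : {σ : Set} → σ → SimpleFormula σ → Set
PositiveIn q (K , f) = Σ K (λ k → 𝓛 (f k) (pos q) ⊎ 𝓛 (f k) (negneg q))

Edge : {σ : Set} → SimpleProgram σ → σ → σ → Set
Edge (R , rs) p q = Σ R (λ r → head (rs r) p × PositiveIn q (body (rs r)))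

FTCritical : {σ : Set} → SimpleProgram σ → σ → σ → Set
FTCritical (R , rs) p q =
  Σ R (λ r → head (rs r) p ×
    Σ (proj₁ (body (rs r))) (λ k →
      NonPositive (proj₂ (body (rs r)) k) × 𝓛 (proj₂ (body (rs r)) k) (pos q)))
  where open Data.Product using (proj₂)

FLPCritical : {σ : Set} → SimpleProgram σ → σ → σ → Set
FLPCritical (R , rs) p q =
  Σ R (λ r → head (rs r) p ×
    Σ (proj₁ (body (rs r))) (λ k → 𝓛 (proj₂ (body (rs r)) k) (negneg q)))
  where open Data.Product using (proj₂)

IsPath : {σ : Set} → SimpleProgram σ → (ℕ → σ) → Set
IsPath 𝓗 v = (n : ℕ) → Edge 𝓗 (v n) (v (suc n))

InfinitelyMany : {σ : Set} → (σ → σ → Set) → (ℕ → σ) → Set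
InfinitelyMany C v = (n : ℕ) → Σ ℕ (λ m → n ≤ m × C (v m) (v (suc m)))

FTTight : {σ : Set} → SimpleProgram σ → Set
FTTight {σ} 𝓗 = ¬ (Σ (ℕ → σ) (λ v → IsPath 𝓗 v × InfinitelyMany (FTCritical 𝓗) v))

FLPTight : {σ : Set} → SimpleProgram σ → Set
FLPTight {σ} 𝓗 = ¬ (Σ (ℕ → σ) (λ v → IsPath 𝓗 v × InfinitelyMany (FLPCritical 𝓗) v))

FLP : {σ : Set} → SimpleProgram σ → Interp σ → FormulaSet σ
FLP (R , rs) I = Σ R (λ r → I ⊨ ⟦ body (rs r) ⟧ᶠ) , (λ x → ⟦ rs (proj₁ x) ⟧ʳ)

FLPStable : {σ : Set} → SimpleProgram σ → Interp σ → Set₁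
FLPStable 𝓗 I = MinimalModel I (FLP 𝓗 I)

FT : {σ : Set} → ExcludedMiddle 0ℓ → Interp σ → Formula σ → Formula σ
FT lem I (atom p) with lem {I p}
... | yes _ = atom p
... | no  _ = ⊥F
FT lem I (⋀ K f) = ⋀ K (λ k → FT lem I (f k))
FT lem I (⋁ K f) = ⋁ K (λ k → FT lem I (f k))
FT lem I (F ⇒ G) with lem {I ⊨ (F ⇒ G)}
... | yes _ = FT lem I F ⇒ FT lem I G
... | no  _ = ⊥F

FTˢ : {σ : Set} → ExcludedMiddle 0ℓ → FormulaSet σ → Interp σ → FormulaSet σ
FTˢ lem (K , f) I = K , (λ k → FT lem I (f k))

FTStable : {σ : Set} → ExcludedMiddle 0ℓ → SimpleProgram σ → Interp σ → Set₁
FTStable lem 𝓗 I = MinimalModel I (FTˢ lem ⟦ 𝓗 ⟧ᵖ I)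

-- Let I be stable for one reduct, M ⊆ I a model of the other, and suppose B = I ∖ M is
-- nonempty. If every atom of B had a dependency walk ending in a critical edge into B,
-- chaining such walks would give a path with infinitely many critical edges; so, by
-- tightness, some p ∈ B has none. The set T of atoms of B reachable from p is closed under
-- dependency edges within B and receives no critical edge from B, and this is exactly
-- what makes I ∖ T a model of the first reduct, contradicting the minimality of I.

module Submission where

open import Defs
open import Level using (0ℓ)
open import Data.Product using (Σ; _×_; _,_; proj₁; proj₂)
open import Data.Sum using (inj₁; inj₂)
open import Data.Empty using (⊥-elim)
open import Data.Nat using (ℕ; zero; suc; z≤n; s≤s)
open import Data.Nat.GeneralisedArithmetic using (iterate)
open import Function.Bundles using (_⇔_; mk⇔; Equivalence)
open import Relation.Nullary using (¬_; Dec; yes; no)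
open import Relation.Binary.Construct.Closure.ReflexiveTransitive using (Star; ε; _◅_; _◅◅_)
open import Axiom.ExcludedMiddle using (ExcludedMiddle)
open import Axiom.DoubleNegationElimination using (em⇒dne)

open Equivalence using (to; from)

module _ {σ : Set} (E C : σ → σ → Set) where

  InfiniteCriticalPath : Set
  InfiniteCriticalPath =
    Σ (ℕ → σ) λ v → (∀ n → E (v n) (v (suc n))) × InfinitelyMany C v

  record CriticalEscape (B : Interp σ) (x : σ) : Set where
    constructor escape
    field
      {last next} : σ
      walk     : Star E x last
      edge     : E last next
      critical : C last next
      lands    : B next

  module _ {B : Interp σ} (escapeFrom : ∀ {x} → B x → CriticalEscape B x) where

    private
      Position : Set
      Position = Σ σ (CriticalEscape B)

      advance : Position → Position
      advance (_ , escape ε _ _ b)        = _ , escapeFrom b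
      advance (_ , escape (_ ◅ w) e c b) = _ , escape w e c b

      advance-edge : ∀ s → E (proj₁ s) (proj₁ (advance s))
      advance-edge (_ , escape ε e _ _)     = e
      advance-edge (_ , escape (e ◅ _) _ _ _) = e

      node : Position → ℕ → σ
      node s n = proj₁ (iterate advance s n)

      orbit-edge : ∀ s n → E (node s n) (node s (suc n))
      orbit-edge s zero    = advance-edge s
      orbit-edge s (suc n) = orbit-edge (advance s) n

      critical-ahead : ∀ {x y z} (w : Star E x y) (e : E y z) (c : C y z) (b : B z) →
                       let s = x , escape w e c b in Σ ℕ λ k → C (node s k) (node s (suc k))
      critical-ahead ε       _ c _ = 0 , c
      critical-ahead (_ ◅ w) e c b = let k , ck = critical-ahead w e c b in suc k , ck

      orbit-critical : ∀ s → InfinitelyMany C (node s)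
      orbit-critical (_ , escape w e c b) zero =
        let k , ck = critical-ahead w e c b in k , z≤n , ck
      orbit-critical s (suc n) =
        let m , n≤m , cm = orbit-critical (advance s) n in suc m , s≤s n≤m , cm

    infinite-critical-path : ∀ {x} → B x → InfiniteCriticalPath
    infinite-critical-path b = node s , orbit-edge s , orbit-critical s
      where s = _ , escapeFrom b

  escape-free-point : ExcludedMiddle 0ℓ → ¬ InfiniteCriticalPath →
                      ∀ {B x} → B x → Σ σ λ p → B p × ¬ CriticalEscape B p
  escape-free-point lem no-path {B} b with lem {Σ σ λ p → B p × ¬ CriticalEscape B p}
  ... | yes found = found
  ... | no none   = ⊥-elim (no-path (infinite-critical-path escapeFrom b))
    where
    escapeFrom : ∀ {x} → B x → CriticalEscape B x
    escapeFrom {x} bx = em⇒dne lem λ ¬escape → none (x , bx , ¬escape)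

  record CriticalFreeCore (B : Interp σ) : Set₁ where
    field
      T             : Interp σ
      point         : σ
      point∈T       : T point
      T⊆B           : T ⊆ B
      closed        : ∀ {h q} → T h → E h q → B q → T q
      critical-free : ∀ {h q} → T h → E h q → C h q → ¬ B q

  critical-free-core : ExcludedMiddle 0ℓ → ¬ InfiniteCriticalPath →
                       ∀ {B x} → B x → CriticalFreeCore B
  critical-free-core lem no-path {B} b with escape-free-point lem no-path b
  ... | p , bp , ¬escape = record
    { T             = λ q → B q × Star E p q
    ; point         = p
    ; point∈T       = bp , ε
    ; T⊆B           = λ _ → proj₁
    ; closed        = λ (_ , w) e bq → bq , w ◅◅ e ◅ ε
    ; critical-free = λ (_ , w) e c bq → ¬escape (escape w e c bq)
    }

module _ {σ : Set} where

  infixl 25 _∖_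
  _∖_ : Interp σ → Interp σ → Interp σ
  (I ∖ J) p = I p × ¬ J p

  ⊆-refl : {I : Interp σ} → I ⊆ I
  ⊆-refl _ Ip = Ip

  ⊆-∖-swap : {I M T : Interp σ} → M ⊆ I → T ⊆ I ∖ M → M ⊆ I ∖ T
  ⊆-∖-swap M⊆I T⊆I∖M p Mp = M⊆I p Mp , λ Tp → proj₂ (T⊆I∖M p Tp) Mp

  ∖-empty⇒⊆ : ExcludedMiddle 0ℓ → {I M : Interp σ} →
              (∀ p → ¬ (I ∖ M) p) → I ⊆ M
  ∖-empty⇒⊆ lem empty p Ip = em⇒dne lem λ ¬Mp → empty p (Ip , ¬Mp)

  MinimalModel⇒∖⊭ : {I : Interp σ} {S : FormulaSet σ} → MinimalModel I S →
                    (T : Interp σ) {p : σ} → T p → I p → ¬ (I ∖ T) ⊨ˢ S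
  MinimalModel⇒∖⊭ (_ , minimal) T Tp Ip I∖T⊨S =
    proj₂ (minimal _ (λ _ → proj₁) I∖T⊨S _ Ip) Tp

  antecedent consequent : SimpleImpl σ → Formula σ
  antecedent s = ⋀ (Σ _ (𝓐 s)) (λ a → atom (proj₁ a))
  consequent s = ⋁ (Σ _ (𝓛 s)) (λ l → ⟦ proj₁ l ⟧ˡ)

  rule-head : SimpleRule σ → Formula σ
  rule-head r = ⋁ (Σ _ (head r)) (λ a → atom (proj₁ a))

module _ (lem : ExcludedMiddle 0ℓ) {σ : Set} {I J : Interp σ} where

  ⊨FT⇒⊨ : J ⊆ I → ∀ F → J ⊨ FT lem I F → I ⊨ F
  ⊨FT⇒⊨ J⊆I (atom p) J⊨F with lem {I p}
  ... | yes _ = J⊆I p J⊨F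
  ... | no  _ = ⊥-elim (proj₁ J⊨F)
  ⊨FT⇒⊨ J⊆I (⋀ K f) J⊨F = λ k → ⊨FT⇒⊨ J⊆I (f k) (J⊨F k)
  ⊨FT⇒⊨ J⊆I (⋁ K f) (k , J⊨fk) = k , ⊨FT⇒⊨ J⊆I (f k) J⊨fk
  ⊨FT⇒⊨ J⊆I (F ⇒ G) J⊨F with lem {I ⊨ (F ⇒ G)}
  ... | yes I⊨F⇒G = I⊨F⇒G
  ... | no  _     = ⊥-elim (proj₁ J⊨F)

  ⊨FT-atom : J ⊆ I → ∀ {p} → J ⊨ FT lem I (atom p) ⇔ J p
  ⊨FT-atom J⊆I {p} with lem {I p}
  ... | yes _  = mk⇔ (λ Jp → Jp) (λ Jp → Jp)
  ... | no ¬Ip = mk⇔ (λ J⊨⊥ → ⊥-elim (proj₁ J⊨⊥)) (λ Jp → ⊥-elim (¬Ip (J⊆I p Jp)))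

  ⊨FT-⇒ : ∀ {F G} → I ⊨ (F ⇒ G) →
          J ⊨ FT lem I (F ⇒ G) ⇔ (J ⊨ FT lem I F → J ⊨ FT lem I G)
  ⊨FT-⇒ {F} {G} I⊨F⇒G with lem {I ⊨ (F ⇒ G)}
  ... | yes _     = mk⇔ (λ f → f) (λ f → f)
  ... | no ¬I⊨F⇒G = ⊥-elim (¬I⊨F⇒G I⊨F⇒G)

  ⊨FT-¬ : J ⊆ I → ∀ {F} → I ⊨ ¬F F → J ⊨ FT lem I (¬F F)
  ⊨FT-¬ J⊆I {F} I⊨¬F =
    from (⊨FT-⇒ I⊨¬F) λ J⊨F → ⊥-elim (proj₁ (I⊨¬F (⊨FT⇒⊨ J⊆I F J⊨F)))

⊨⇒⊨FT : (lem : ExcludedMiddle 0ℓ) {σ : Set} {I : Interp σ} →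
        ∀ F → I ⊨ F → I ⊨ FT lem I F
⊨⇒⊨FT lem {I = I} (atom p) Ip with lem {I p}
... | yes _  = Ip
... | no ¬Ip = ⊥-elim (¬Ip Ip)
⊨⇒⊨FT lem (⋀ K f) I⊨F = λ k → ⊨⇒⊨FT lem (f k) (I⊨F k)
⊨⇒⊨FT lem (⋁ K f) (k , I⊨fk) = k , ⊨⇒⊨FT lem (f k) I⊨fk
⊨⇒⊨FT lem (F ⇒ G) I⊨F⇒G =
  from (⊨FT-⇒ lem I⊨F⇒G) λ I⊨FTF → ⊨⇒⊨FT lem G (I⊨F⇒G (⊨FT⇒⊨ lem ⊆-refl F I⊨FTF))

module _ (lem : ExcludedMiddle 0ℓ) {σ : Set} {R : Set} (rs : R → SimpleRule σ) where

  private
    𝓗 : SimpleProgram σ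
    𝓗 = R , rs

    term : (r : R) → proj₁ (body (rs r)) → SimpleImpl σ
    term r = proj₂ (body (rs r))

    dne : {P : Set} → ¬ ¬ P → P
    dne = em⇒dne lem

  module _ {I J : Interp σ} (J⊆I : J ⊆ I) (I⊨𝓗 : ∀ r → I ⊨ ⟦ rs r ⟧ʳ)
           (J⊨FT : J ⊨ˢ FTˢ lem ⟦ 𝓗 ⟧ᵖ I)
           (core : CriticalFreeCore (Edge 𝓗) (FTCritical 𝓗) (I ∖ J)) where

    open CriticalFreeCore core

    private
      J⊆I∖T : J ⊆ I ∖ T
      J⊆I∖T = ⊆-∖-swap J⊆I T⊆B

    -- A literal of a non-positive term is taken from I ⊨ s (T has no critical entry),
    -- one of a positive term from I ∖ T ⊨ s (T is closed).
    term-⊨FT : ∀ {r h} → T h → head (rs r) h →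
               ∀ k → I ⊨ ⟦ term r k ⟧ⁱ → I ∖ T ⊨ ⟦ term r k ⟧ⁱ → J ⊨ FT lem I ⟦ term r k ⟧ⁱ
    term-⊨FT {r} Th hr k I⊨s I∖T⊨s =
      from (⊨FT-⇒ lem I⊨s) (by-positivity (lem {NonPositive s}))
      where
      s = term r k

      J-atoms : J ⊨ FT lem I (antecedent s) → ∀ a → J (proj₁ a)
      J-atoms J⊨A a = to (⊨FT-atom lem J⊆I) (J⊨A a)

      by-positivity : Dec (NonPositive s) →
                      J ⊨ FT lem I (antecedent s) → J ⊨ FT lem I (consequent s)
      by-positivity (yes nonpositive) J⊨A =
        let (l , l∈) , I⊨l = I⊨s (λ a → J⊆I _ (J-atoms J⊨A a))
        in (l , l∈) , literal l l∈ I⊨l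
        where
        literal : ∀ l → 𝓛 s l → I ⊨ ⟦ l ⟧ˡ → J ⊨ FT lem I ⟦ l ⟧ˡ
        literal (pos q) l∈ Iq = from (⊨FT-atom lem J⊆I) (dne λ ¬Jq →
          critical-free Th (r , hr , k , inj₁ l∈) (r , hr , k , nonpositive , l∈) (Iq , ¬Jq))
        literal (neg q)    _ I⊨l = ⊨FT-¬ lem J⊆I I⊨l
        literal (negneg q) _ I⊨l = ⊨FT-¬ lem J⊆I I⊨l
      by-positivity (no positive) J⊨A =
        let (l , l∈) , I∖T⊨l = I∖T⊨s (λ a → J⊆I∖T _ (J-atoms J⊨A a))
        in (l , l∈) , literal l l∈ I∖T⊨l
        where
        literal : ∀ l → 𝓛 s l → I ∖ T ⊨ ⟦ l ⟧ˡ → J ⊨ FT lem I ⟦ l ⟧ˡ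
        literal (pos q) l∈ (Iq , ¬Tq) = from (⊨FT-atom lem J⊆I) (dne λ ¬Jq →
          ¬Tq (closed Th (r , hr , k , inj₁ l∈) (Iq , ¬Jq)))
        literal (neg q)    l∈ _ = ⊥-elim (positive (q , inj₁ l∈))
        literal (negneg q) l∈ _ = ⊥-elim (positive (q , inj₂ l∈))

    I∖T⊨FLP : I ∖ T ⊨ˢ FLP 𝓗 I
    I∖T⊨FLP (r , I⊨G) I∖T⊨G with I⊨𝓗 r I⊨G
    ... | (h , hr) , Ih with lem {T h}
    ... | no ¬Th = (h , hr) , Ih , ¬Th
    ... | yes Th =
      let J⊨G = λ k → term-⊨FT Th hr k (I⊨G k) (I∖T⊨G k)
          (h′ , hr′) , J⊨h′ = to (⊨FT-⇒ lem (I⊨𝓗 r)) (J⊨FT r) J⊨G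
      in (h′ , hr′) , J⊆I∖T h′ (to (⊨FT-atom lem J⊆I) J⊨h′)

  module _ {I K : Interp σ} (K⊆I : K ⊆ I) (I⊨𝓗 : ∀ r → I ⊨ ⟦ rs r ⟧ʳ)
           (K⊨FLP : K ⊨ˢ FLP 𝓗 I)
           (core : CriticalFreeCore (Edge 𝓗) (FLPCritical 𝓗) (I ∖ K)) where

    open CriticalFreeCore core

    private
      K⊆I∖T : K ⊆ I ∖ T
      K⊆I∖T = ⊆-∖-swap K⊆I T⊆B

      I∖T⊆I : I ∖ T ⊆ I
      I∖T⊆I _ = proj₁

    term-⊨ : ∀ {r h} → T h → head (rs r) h →
             ∀ k → I ⊨ ⟦ term r k ⟧ⁱ → I ∖ T ⊨ FT lem I ⟦ term r k ⟧ⁱ → K ⊨ ⟦ term r k ⟧ⁱ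
    term-⊨ {r} Th hr k I⊨s I∖T⊨s K⊨A =
      let (l , l∈) , I∖T⊨l = to (⊨FT-⇒ lem I⊨s) I∖T⊨s
                               (λ a → from (⊨FT-atom lem I∖T⊆I) (K⊆I∖T _ (K⊨A a)))
      in (l , l∈) , literal l l∈ I∖T⊨l
      where
      s = term r k

      literal : ∀ l → 𝓛 s l → I ∖ T ⊨ FT lem I ⟦ l ⟧ˡ → K ⊨ ⟦ l ⟧ˡ
      literal (pos q) l∈ I∖T⊨q =
        let Iq , ¬Tq = to (⊨FT-atom lem I∖T⊆I) I∖T⊨q
        in dne λ ¬Kq → ¬Tq (closed Th (r , hr , k , inj₁ l∈) (Iq , ¬Kq))
      literal (neg q) _ I∖T⊨l Kq =
        ⊥-elim (proj₁ (⊨FT⇒⊨ lem I∖T⊆I (¬F (atom q)) I∖T⊨l (K⊆I q Kq)))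
      literal (negneg q) l∈ I∖T⊨l ¬Kq = ⊥-elim
        (critical-free Th (r , hr , k , inj₂ l∈) (r , hr , k , l∈) (Iq , λ Kq → proj₁ (¬Kq Kq)))
        where
        I⊨¬¬q : I ⊨ ¬F (¬F (atom q))
        I⊨¬¬q = ⊨FT⇒⊨ lem I∖T⊆I (¬F (¬F (atom q))) I∖T⊨l

        Iq : I q
        Iq = dne λ ¬Iq → proj₁ (I⊨¬¬q λ Iq → ⊥-elim (¬Iq Iq))

    I∖T⊨FT : I ∖ T ⊨ˢ FTˢ lem ⟦ 𝓗 ⟧ᵖ I
    I∖T⊨FT r = from (⊨FT-⇒ lem (I⊨𝓗 r)) λ I∖T⊨G →
      head-⊨FT (⊨FT⇒⊨ lem I∖T⊆I ⟦ body (rs r) ⟧ᶠ I∖T⊨G) I∖T⊨G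
      where
      head-⊨FT : I ⊨ ⟦ body (rs r) ⟧ᶠ → I ∖ T ⊨ FT lem I ⟦ body (rs r) ⟧ᶠ →
                 I ∖ T ⊨ FT lem I (rule-head (rs r))
      head-⊨FT I⊨G I∖T⊨G with I⊨𝓗 r I⊨G
      ... | (h , hr) , Ih with lem {T h}
      ... | no ¬Th = (h , hr) , from (⊨FT-atom lem I∖T⊆I) (Ih , ¬Th)
      ... | yes Th =
        let K⊨G = λ k → term-⊨ Th hr k (I⊨G k) (I∖T⊨G k)
            (h′ , hr′) , Kh′ = K⊨FLP (r , I⊨G) K⊨G
        in (h′ , hr′) , from (⊨FT-atom lem I∖T⊆I) (K⊆I∖T h′ Kh′)

FLPStable⇒FTStable : (lem : ExcludedMiddle 0ℓ) {σ : Set} (𝓗 : SimpleProgram σ) →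
                     FTTight 𝓗 → (I : Interp σ) → FLPStable 𝓗 I → FTStable lem 𝓗 I
FLPStable⇒FTStable lem (R , rs) tight I stable = I⊨FT , FT-minimal
  where
  I⊨𝓗 : ∀ r → I ⊨ ⟦ rs r ⟧ʳ
  I⊨𝓗 r I⊨G = proj₁ stable (r , I⊨G) I⊨G

  I⊨FT : I ⊨ˢ FTˢ lem ⟦ R , rs ⟧ᵖ I
  I⊨FT r = ⊨⇒⊨FT lem ⟦ rs r ⟧ʳ (I⊨𝓗 r)

  FT-minimal : ∀ J → J ⊆ I → J ⊨ˢ FTˢ lem ⟦ R , rs ⟧ᵖ I → I ⊆ J
  FT-minimal J J⊆I J⊨FT = ∖-empty⇒⊆ lem λ _ I∖Jp →
    let core = critical-free-core (Edge (R , rs)) (FTCritical (R , rs)) lem tight I∖Jp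
        open CriticalFreeCore core
    in MinimalModel⇒∖⊭ {S = FLP (R , rs) I} stable T point∈T
                       (proj₁ (T⊆B point point∈T)) (I∖T⊨FLP lem rs J⊆I I⊨𝓗 J⊨FT core)

FTStable⇒FLPStable : (lem : ExcludedMiddle 0ℓ) {σ : Set} (𝓗 : SimpleProgram σ) →
                     FLPTight 𝓗 → (I : Interp σ) → FTStable lem 𝓗 I → FLPStable 𝓗 I
FTStable⇒FLPStable lem (R , rs) tight I stable = (λ (r , _) → I⊨𝓗 r) , FLP-minimal
  where
  I⊨𝓗 : ∀ r → I ⊨ ⟦ rs r ⟧ʳ
  I⊨𝓗 r = ⊨FT⇒⊨ lem ⊆-refl ⟦ rs r ⟧ʳ (proj₁ stable r)

  FLP-minimal : ∀ K → K ⊆ I → K ⊨ˢ FLP (R , rs) I → I ⊆ K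
  FLP-minimal K K⊆I K⊨FLP = ∖-empty⇒⊆ lem λ _ I∖Kp →
    let core = critical-free-core (Edge (R , rs)) (FLPCritical (R , rs)) lem tight I∖Kp
        open CriticalFreeCore core
    in MinimalModel⇒∖⊭ {S = FTˢ lem ⟦ R , rs ⟧ᵖ I} stable T point∈T
                       (proj₁ (T⊆B point point∈T)) (I∖T⊨FT lem rs K⊆I I⊨𝓗 K⊨FLP core)

mainTheorem2 : (lem : ExcludedMiddle 0ℓ) {σ : Set} (𝓗 : SimpleProgram σ) →
    (FTTight 𝓗 → (I : Interp σ) → FLPStable 𝓗 I → FTStable lem 𝓗 I)
    × (FLPTight 𝓗 → (I : Interp σ) → FTStable lem 𝓗 I → FLPStable 𝓗 I)
mainTheorem2 lem 𝓗 = FLPStable⇒FTStable lem 𝓗 , FTStable⇒FLPStable lem 𝓗
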